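{- Let $n\ge 2$, let $\pi\in\mathcal{S}^{(n)}$ and let $j\in\{2,\dots,n\}$ be such that $\pi(j)=1$. Define $\sigma\in\mathcal{S}^{(n)}$ by $$\sigma(1)=\pi(2),\ \sigma(2)=\pi(3),\ \dots,\ \sigma(j-2)=\pi(j-1),\ \sigma(j-1)=\pi(1),$$ $$\sigma(j)=\pi(j)=1,\ \sigma(j+1)=\pi(j+1),\ \dots,\ \sigma(n)=\pi(n).$$ Define $\pi^*\in\mathcal{S}^{(n-1)}$ by $\pi^*(i)=\sigma(i)-1$ if $1\le i\le j-1$, and $\pi^*(i)=\sigma(i+1)-1$ if $j\le i\le n-1$. Then $\gamma(\pi)=\gamma(\pi^*)$.
   Context: $\mathcal{S}^{(n)}$ denotes the symmetric group of permutations of $\{1,\dots,n\}$. For a permutation $s$, $\gamma(s)$ denotes the number of cycles in the disjoint cycle decomposition of $s$, counting fixed points (cycles of length $1$). -}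

module Defs where

open import Data.Nat using (ℕ; zero; suc; _≤ᵇ_; _<?_; _≟_)
open import Data.Nat.Properties using (<-trans)
open import Data.Fin using (Fin; zero; suc; toℕ; fromℕ<; inject₁)
open import Data.Fin.Properties using (toℕ<n)
open import Data.Fin.Permutation using (Permutation′; _⟨$⟩ʳ_)
open import Data.List using (List; allFin; upTo; map)
open import Data.Bool.ListAction using (and)
open import Data.Nat.ListAction using (sum)
open import Data.Bool using (Bool; if_then_else_)
open import Relation.Nullary using (yes; no)

iter : ∀ {n} → (Fin n → Fin n) → ℕ → Fin n → Fin n
iter f zero    x = x
iter f (suc k) x = f (iter f k x)

-- i is the smallest element (w.r.t. the usual order) of its cycle under f:
-- toℕ i ≤ toℕ (f^k i) for all 0 ≤ k < n (a cycle has length ≤ n).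
isCycleMin : ∀ {n} → (Fin n → Fin n) → Fin n → Bool
isCycleMin {n} f i = and (map (λ k → toℕ i ≤ᵇ toℕ (iter f k i)) (upTo n))

-- γ(s): number of cycles of s (fixed points included), counted as the
-- number of cycles = number of cycle minima.
γ : ∀ {n} → Permutation′ n → ℕ
γ {n} s = sum (map (λ i → if isCycleMin (s ⟨$⟩ʳ_) i then 1 else 0) (allFin n))

-- 0-indexed: Fin (suc m) = {0..m} represents {1..n}, n = suc m.
-- With j0 = toℕ j (paper's j = j0 + 1), σ = π ∘ ρ where
--   ρ i = i+1 if i+1 < j0,   ρ i = 0 if i+1 = j0,   ρ i = i if i ≥ j0.
ρ : ∀ {m} → Fin (suc m) → Fin (suc m) → Fin (suc m)
ρ j i with suc (toℕ i) <? toℕ j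
... | yes p = fromℕ< (<-trans p (toℕ<n j))
... | no _ with suc (toℕ i) ≟ toℕ j
...   | yes _ = zero
...   | no _  = i

σ : ∀ {m} → Permutation′ (suc m) → Fin (suc m) → Fin (suc m) → Fin (suc m)
σ π j i = π ⟨$⟩ʳ ρ j i

idx : ∀ {m} → Fin (suc m) → Fin m → Fin (suc m)
idx j i with toℕ i <? toℕ j
... | yes _ = inject₁ i
... | no _  = suc i

-- π⋆ is π with the point j cut out of its cycle (its predecessor now maps straight to π j = 0),
-- relabelled along the bijection φ from Fin m onto the points ≠ j, with inverse ψ. Since π j ≠ j,
-- cutting j out destroys no cycle, so the number of cycles is unchanged. Cycles are counted by
-- their minima; each of γ π ≤ γ π⋆ and γ π⋆ ≤ γ π comes from a map (ψ, resp. φ) reflecting the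
-- orbit relation, since sending a cycle minimum to the minimum of the cycle of its image is then
-- injective.
module Submission where

open import Defs
open import Data.Bool using (Bool; true; false; T; if_then_else_; not; _∧_)
open import Data.Empty using (⊥-elim)
open import Data.Fin using (Fin; zero; suc; toℕ; inject₁)
open import Data.Fin.Permutation using (Permutation′; _⟨$⟩ʳ_; _⟨$⟩ˡ_; permutation; inverseˡ; inverseʳ)
import Data.Fin.Properties as Fin
open import Data.List using (map; allFin; upTo; applyUpTo)
open import Data.List.Membership.Propositional.Properties using (∈-applyUpTo⁺; ∈-applyUpTo⁻; ∈-upTo⁺)
open import Data.List.Properties using (map-cong; map-tabulate)
import Data.List.Relation.Unary.All as All
open import Data.List.Relation.Unary.All.Properties using (all⁺; all⁻)
open import Data.Nat using (ℕ; zero; suc; _+_; _∸_; _≤_; _<_; _≤ᵇ_; _<?_; z≤n; s≤s; s≤s⁻¹; s<s)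
open import Data.Nat.ListAction using (sum)
open import Data.Nat.Properties
  using (_≟_; ≤-totalOrder; ≤-trans; ≤-antisym; <-trans; <-irrefl; <⇒≤; <⇒≱; <-≤-trans; n<1+n; m≤n⇒m≤1+n; m<n⇒m<1+n;
         m≤n⇒m<n∨m≡n; m<n⇒0<n∸m; m∸n≤m; m+[n∸m]≡n; m∸n+n≡m; +-suc; ≤ᵇ⇒≤; ≤⇒≤ᵇ; module ≤-Reasoning)
open import Data.List.Extrema ≤-totalOrder using (argmin; argmin-sel; f[argmin]≤f[xs])
open import Data.Product using (Σ; ∃-syntax; _×_; _,_)
open import Data.Sum using (inj₁; inj₂)
open import Function using (_∘_)
open import Relation.Binary using (tri<; tri≈; tri>)
open import Relation.Binary.PropositionalEquality
open import Relation.Nullary using (yes; no; does)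

private
  variable
    n : ℕ

Orbit : (Fin n → Fin n) → Fin n → Fin n → Set
Orbit f x y = ∃[ k ] iter f k x ≡ y

module _ {f : Fin n → Fin n} where

  iter-+ : ∀ l k x → iter f (l + k) x ≡ iter f l (iter f k x)
  iter-+ zero    k x = refl
  iter-+ (suc l) k x = cong f (iter-+ l k x)

  orbit-refl : ∀ {x} → Orbit f x x
  orbit-refl = 0 , refl

  orbit-step : ∀ {x} → Orbit f x (f x)
  orbit-step = 1 , refl

  orbit-trans : ∀ {x y z} → Orbit f x y → Orbit f y z → Orbit f x z
  orbit-trans {x} (k , refl) (l , refl) = l + k , iter-+ l k x

  orbit-mono : ∀ {g : Fin n → Fin n} → (∀ x → Orbit f x (g x)) → ∀ {x y} → Orbit g x y → Orbit f x y
  orbit-mono g⊆f (zero  , refl) = orbit-refl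
  orbit-mono g⊆f (suc k , refl) = orbit-trans (orbit-mono g⊆f (k , refl)) (g⊆f _)

  iter-periodic : ∀ {p x} → 0 < p → iter f p x ≡ x → ∀ k → ∃[ r ] r < p × iter f k x ≡ iter f r x
  iter-periodic 0<p fᵖx≡x zero = 0 , 0<p , refl
  iter-periodic {p} {x} 0<p fᵖx≡x (suc k) with iter-periodic 0<p fᵖx≡x k
  ... | r , r<p , eq with m≤n⇒m<n∨m≡n r<p
  ...   | inj₁ 1+r<p  = suc r , 1+r<p , cong f eq
  ...   | inj₂ 1+r≡p = 0 , 0<p , trans (cong f eq) (trans (cong (λ q → iter f q x) 1+r≡p) fᵖx≡x)

module _ {a b} {f : Fin a → Fin a} {g : Fin b → Fin b} {h : Fin a → Fin b}
         (h∘f≗g∘h : ∀ z → h (f z) ≡ g (h z)) where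

  iter-conj : ∀ k z → h (iter f k z) ≡ iter g k (h z)
  iter-conj zero    z = refl
  iter-conj (suc k) z = trans (h∘f≗g∘h (iter f k z)) (cong g (iter-conj k z))

  orbit-conj⁺ : ∀ {x y} → Orbit f x y → Orbit g (h x) (h y)
  orbit-conj⁺ {x} (k , refl) = k , sym (iter-conj k x)

  orbit-conj⁻ : (∀ {x y} → h x ≡ h y → x ≡ y) → ∀ {x y} → Orbit g (h x) (h y) → Orbit f x y
  orbit-conj⁻ h-injective {x} (k , eq) = k , h-injective (trans (iter-conj k x) eq)

IsCycleMin : (Fin n → Fin n) → Fin n → Set
IsCycleMin f i = ∀ k → toℕ i ≤ toℕ (iter f k i)

cycleMin-unique : ∀ {f : Fin n → Fin n} {x y} → IsCycleMin f x → IsCycleMin f y →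
                  Orbit f x y → Orbit f y x → x ≡ y
cycleMin-unique {x = x} {y} x-min y-min (k , fᵏx≡y) (l , fˡy≡x) = Fin.toℕ-injective (≤-antisym
  (subst (λ w → toℕ x ≤ toℕ w) fᵏx≡y (x-min k)) (subst (λ w → toℕ y ≤ toℕ w) fˡy≡x (y-min l)))

module Cycles (s : Permutation′ n) where

  private
    f : Fin n → Fin n
    f = s ⟨$⟩ʳ_

  iter-injective : ∀ k {x y} → iter f k x ≡ iter f k y → x ≡ y
  iter-injective zero    eq = eq
  iter-injective (suc k) eq =
    iter-injective k (trans (sym (inverseˡ s)) (trans (cong (s ⟨$⟩ˡ_) eq) (inverseˡ s)))

  period : ∀ x → ∃[ p ] 0 < p × p ≤ n × iter f p x ≡ x
  period x with Fin.pigeonhole (n<1+n n) (λ i → iter f (toℕ i) x)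
  ... | i , j , i<j , fⁱx≡fʲx =
    toℕ j ∸ toℕ i , m<n⇒0<n∸m i<j , ≤-trans (m∸n≤m (toℕ j) (toℕ i)) (s≤s⁻¹ (Fin.toℕ<n j)) ,
    iter-injective (toℕ i) (begin
      iter f (toℕ i) (iter f (toℕ j ∸ toℕ i) x) ≡⟨ iter-+ (toℕ i) _ x ⟨
      iter f (toℕ i + (toℕ j ∸ toℕ i)) x        ≡⟨ cong (λ q → iter f q x) (m+[n∸m]≡n (<⇒≤ i<j)) ⟩
      iter f (toℕ j) x                          ≡⟨ fⁱx≡fʲx ⟨
      iter f (toℕ i) x                          ∎)
    where open ≡-Reasoning

  iter-below : ∀ x k → ∃[ r ] r < n × iter f k x ≡ iter f r x
  iter-below x k with period x
  ... | p , 0<p , p≤n , fᵖx≡x with iter-periodic 0<p fᵖx≡x k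
  ...   | r , r<p , eq = r , <-≤-trans r<p p≤n , eq

  orbit-sym : ∀ {x y} → Orbit f x y → Orbit f y x
  orbit-sym {x} (k , refl) with period x
  ... | p , 0<p , _ , fᵖx≡x with iter-periodic 0<p fᵖx≡x k
  ...   | r , r<p , fᵏx≡fʳx = p ∸ r , (begin
    iter f (p ∸ r) (iter f k x) ≡⟨ cong (iter f (p ∸ r)) fᵏx≡fʳx ⟩
    iter f (p ∸ r) (iter f r x) ≡⟨ iter-+ (p ∸ r) r x ⟨
    iter f (p ∸ r + r) x        ≡⟨ cong (λ q → iter f q x) (m∸n+n≡m (<⇒≤ r<p)) ⟩
    iter f p x                  ≡⟨ fᵖx≡x ⟩
    x                           ∎)
    where open ≡-Reasoning

  isCycleMin⇒IsCycleMin : ∀ {i} → T (isCycleMin f i) → IsCycleMin f i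
  isCycleMin⇒IsCycleMin {i} t k with iter-below i k
  ... | r , r<n , fᵏi≡fʳi = subst (λ w → toℕ i ≤ toℕ w) (sym fᵏi≡fʳi)
    (≤ᵇ⇒≤ _ _ (All.lookup (all⁺ (λ k → toℕ i ≤ᵇ toℕ (iter f k i)) (upTo n) t) (∈-upTo⁺ r<n)))

  IsCycleMin⇒isCycleMin : ∀ {i} → IsCycleMin f i → T (isCycleMin f i)
  IsCycleMin⇒isCycleMin {i} i-min =
    all⁻ (λ k → toℕ i ≤ᵇ toℕ (iter f k i)) {xs = upTo n} (All.tabulate (λ {k} _ → ≤⇒≤ᵇ (i-min k)))

  cycleMin : Fin n → Fin n
  cycleMin x = argmin toℕ x (applyUpTo (λ k → iter f k x) n)

  orbit-cycleMin : ∀ x → Orbit f x (cycleMin x)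
  orbit-cycleMin x with argmin-sel toℕ x (applyUpTo (λ k → iter f k x) n)
  ... | inj₁ min≡x = 0 , sym min≡x
  ... | inj₂ min∈xs with ∈-applyUpTo⁻ (λ k → iter f k x) min∈xs
  ...   | k , _ , min≡fᵏx = k , sym min≡fᵏx

  cycleMin-isCycleMin : ∀ x → T (isCycleMin f (cycleMin x))
  cycleMin-isCycleMin x = IsCycleMin⇒isCycleMin minimal
    where
    minimal : IsCycleMin f (cycleMin x)
    minimal k with orbit-cycleMin x
    ... | l , fˡx≡min with iter-below x (k + l)
    ...   | r , r<n , fᵏ⁺ˡx≡fʳx = subst (λ w → toℕ (cycleMin x) ≤ toℕ w)
      (trans (sym fᵏ⁺ˡx≡fʳx) (trans (iter-+ k l x) (cong (iter f k) fˡx≡min)))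
      (All.lookup (f[argmin]≤f[xs] {f = toℕ} x _) (∈-applyUpTo⁺ (λ k → iter f k x) r<n))

count : (Fin n → Bool) → ℕ
count {n} P = sum (map (λ i → if P i then 1 else 0) (allFin n))

count-cong : ∀ {P Q : Fin n → Bool} → (∀ i → P i ≡ Q i) → count P ≡ count Q
count-cong P≗Q = cong sum (map-cong (λ i → cong (if_then 1 else 0) (P≗Q i)) (allFin _))

count-suc : ∀ (P : Fin (suc n) → Bool) → count P ≡ (if P zero then 1 else 0) + count (P ∘ suc)
count-suc P = cong ((if P zero then 1 else 0) +_) (cong sum
  (trans (map-tabulate suc χ) (sym (map-tabulate (λ i → i) (χ ∘ suc)))))
  where
  χ : Fin _ → ℕ
  χ i = if P i then 1 else 0

erase : (Fin n → Bool) → Fin n → Fin n → Bool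
erase P y x = not (does (x Fin.≟ y)) ∧ P x

erase-T : ∀ {P : Fin n → Bool} {x y} → x ≢ y → T (P x) → T (erase P y x)
erase-T {x = x} {y} x≢y px with x Fin.≟ y
... | yes x≡y = ⊥-elim (x≢y x≡y)
... | no _    = px

count-erase : ∀ (P : Fin n → Bool) {y} → T (P y) → count P ≡ suc (count (erase P y))
count-erase {suc n} P {zero} py rewrite count-suc P | count-suc (erase P zero) with P zero
... | true = cong suc (count-cong {P = P ∘ suc} (λ _ → refl))
count-erase {suc n} P {suc y} py = begin
  count P                                       ≡⟨ count-suc P ⟩
  χ₀ + count (P ∘ suc)                          ≡⟨ cong (χ₀ +_) (count-erase (P ∘ suc) py) ⟩
  χ₀ + suc (count (erase (P ∘ suc) y))          ≡⟨ +-suc χ₀ _ ⟩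
  suc (χ₀ + count (erase (P ∘ suc) y))          ≡⟨ cong (λ c → suc (χ₀ + c)) (count-cong erase-suc) ⟩
  suc (χ₀ + count (erase P (suc y) ∘ suc))      ≡⟨ cong suc (count-suc (erase P (suc y))) ⟨
  suc (count (erase P (suc y)))                 ∎
  where
  open ≡-Reasoning
  χ₀ : ℕ
  χ₀ = if P zero then 1 else 0
  erase-suc : ∀ i → erase (P ∘ suc) y i ≡ erase P (suc y) (suc i)
  erase-suc i with i Fin.≟ y
  ... | yes _ = refl
  ... | no _  = refl

count-≤ : ∀ {a b} (P : Fin a → Bool) (Q : Fin b → Bool) (f : Fin a → Fin b) →
          (∀ {x} → T (P x) → T (Q (f x))) →
          (∀ {x y} → T (P x) → T (P y) → f x ≡ f y → x ≡ y) →
          count P ≤ count Q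
count-≤ {zero}  P Q f P⇒Q f-inj = z≤n
count-≤ {suc a} P Q f P⇒Q f-inj rewrite count-suc P with P zero in p₀
... | false = count-≤ (P ∘ suc) Q (f ∘ suc) P⇒Q f∘suc-inj
  where
  f∘suc-inj : ∀ {x y} → T (P (suc x)) → T (P (suc y)) → f (suc x) ≡ f (suc y) → x ≡ y
  f∘suc-inj px py = Fin.suc-injective ∘ f-inj px py
... | true  = begin
  suc (count (P ∘ suc))          ≤⟨ s≤s (count-≤ (P ∘ suc) (erase Q (f zero)) (f ∘ suc) P∘suc⇒Q′ f∘suc-inj) ⟩
  suc (count (erase Q (f zero))) ≡⟨ count-erase Q (P⇒Q P0) ⟨
  count Q                        ∎
  where
  open ≤-Reasoning
  P0 : T (P zero)
  P0 = subst T (sym p₀) _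
  f∘suc-inj : ∀ {x y} → T (P (suc x)) → T (P (suc y)) → f (suc x) ≡ f (suc y) → x ≡ y
  f∘suc-inj px py = Fin.suc-injective ∘ f-inj px py
  P∘suc⇒Q′ : ∀ {x} → T (P (suc x)) → T (erase Q (f zero) (f (suc x)))
  P∘suc⇒Q′ px = erase-T {P = Q} (λ eq → Fin.0≢1+n (sym (f-inj px P0 eq))) (P⇒Q px)

γ-≤ : ∀ {a b} (s : Permutation′ a) (t : Permutation′ b) (h : Fin a → Fin b) →
      (∀ {x y} → Orbit (t ⟨$⟩ʳ_) (h x) (h y) → Orbit (s ⟨$⟩ʳ_) x y) → γ s ≤ γ t
γ-≤ s t h reflects = count-≤ _ _ (Ct.cycleMin ∘ h) (λ _ → Ct.cycleMin-isCycleMin _) injective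
  where
  module Cs = Cycles s
  module Ct = Cycles t
  injective : ∀ {x y} → T (isCycleMin (s ⟨$⟩ʳ_) x) → T (isCycleMin (s ⟨$⟩ʳ_) y) →
              Ct.cycleMin (h x) ≡ Ct.cycleMin (h y) → x ≡ y
  injective {x} {y} x-min y-min eq =
    cycleMin-unique (Cs.isCycleMin⇒IsCycleMin x-min) (Cs.isCycleMin⇒IsCycleMin y-min)
    (reflects hx→hy) (reflects (Ct.orbit-sym hx→hy))
    where
    hx→hy : Orbit (t ⟨$⟩ʳ_) (h x) (h y)
    hx→hy = orbit-trans (Ct.orbit-cycleMin (h x))
      (subst (λ c → Orbit _ c (h y)) (sym eq) (Ct.orbit-sym (Ct.orbit-cycleMin (h y))))

module _ (f : Fin n → Fin n) (j : Fin n) where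

  skip : Fin n → Fin n
  skip x with x Fin.≟ j
  ... | yes _ = f j
  ... | no _  = x

  -- f with j cut out of its cycle
  bypass : Fin n → Fin n
  bypass = skip ∘ f

  skip-≢ : ∀ {x} → x ≢ j → skip x ≡ x
  skip-≢ {x} x≢j with x Fin.≟ j
  ... | yes x≡j = ⊥-elim (x≢j x≡j)
  ... | no _    = refl

  orbit-skip : ∀ x → Orbit f x (skip x)
  orbit-skip x with x Fin.≟ j
  ... | yes refl = orbit-step
  ... | no _     = orbit-refl

  orbit-bypass⇒orbit : ∀ {x y} → Orbit bypass x y → Orbit f x y
  orbit-bypass⇒orbit = orbit-mono (λ x → orbit-trans orbit-step (orbit-skip (f x)))

  module _ (fj≢j : f j ≢ j) where

    orbit-bypass-skip-step : ∀ w → Orbit bypass (skip w) (skip (f w))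
    orbit-bypass-skip-step w with w Fin.≟ j
    ... | yes refl = 0 , sym (skip-≢ fj≢j)
    ... | no _     = orbit-step

    orbit⇒orbit-bypass-skip : ∀ {x y} → Orbit f x y → Orbit bypass (skip x) (skip y)
    orbit⇒orbit-bypass-skip (zero  , refl) = orbit-refl
    orbit⇒orbit-bypass-skip (suc k , refl) =
      orbit-trans (orbit⇒orbit-bypass-skip (k , refl)) (orbit-bypass-skip-step _)

module _ {m} (j : Fin (suc m)) where

  ρ-< : ∀ i → suc (toℕ i) < toℕ j → toℕ (ρ j i) ≡ suc (toℕ i)
  ρ-< i 1+i<j with suc (toℕ i) <? toℕ j
  ... | yes 1+i<j′ = Fin.toℕ-fromℕ< (<-trans 1+i<j′ (Fin.toℕ<n j))
  ... | no  1+i≮j  = ⊥-elim (1+i≮j 1+i<j)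

  ρ-≡ : ∀ i → suc (toℕ i) ≡ toℕ j → ρ j i ≡ zero
  ρ-≡ i 1+i≡j with suc (toℕ i) <? toℕ j
  ... | yes 1+i<j = ⊥-elim (<-irrefl 1+i≡j 1+i<j)
  ... | no _ with suc (toℕ i) ≟ toℕ j
  ...   | yes _    = refl
  ...   | no 1+i≢j = ⊥-elim (1+i≢j 1+i≡j)

  ρ-≥ : ∀ i → toℕ j ≤ toℕ i → ρ j i ≡ i
  ρ-≥ i j≤i with suc (toℕ i) <? toℕ j
  ... | yes 1+i<j = ⊥-elim (<⇒≱ 1+i<j (m≤n⇒m≤1+n j≤i))
  ... | no _ with suc (toℕ i) ≟ toℕ j
  ...   | yes 1+i≡j = ⊥-elim (<-irrefl (sym 1+i≡j) (s≤s j≤i))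
  ...   | no _      = refl

  idx-< : ∀ z → toℕ z < toℕ j → idx j z ≡ inject₁ z
  idx-< z z<j with toℕ z <? toℕ j
  ... | yes _   = refl
  ... | no  z≮j = ⊥-elim (z≮j z<j)

  idx-≥ : ∀ z → toℕ j ≤ toℕ z → idx j z ≡ suc z
  idx-≥ z j≤z with toℕ z <? toℕ j
  ... | yes z<j = ⊥-elim (<⇒≱ z<j j≤z)
  ... | no _    = refl

module Reduction {m} (π : Permutation′ (suc m)) (j′ : Fin m) (πj≡0 : π ⟨$⟩ʳ suc j′ ≡ zero) where

  private
    j : Fin (suc m)
    j = suc j′

    p : Fin (suc m) → Fin (suc m)
    p = π ⟨$⟩ʳ_

  φ : Fin m → Fin (suc m)
  φ z = ρ j (idx j z)

  ψ : Fin (suc m) → Fin m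
  ψ zero    = j′
  ψ (suc x) = x

  φ-j′ : φ j′ ≡ zero
  φ-j′ rewrite idx-< j j′ (n<1+n (toℕ j′)) = ρ-≡ j (inject₁ j′) (cong suc (Fin.toℕ-inject₁ j′))

  φ-≢ : ∀ {z} → z ≢ j′ → φ z ≡ suc z
  φ-≢ {z} z≢j′ with Fin.<-cmp z j′
  ... | tri< z<j′ _ _ rewrite idx-< j z (m<n⇒m<1+n z<j′) = Fin.toℕ-injective (trans
        (ρ-< j (inject₁ z) (s<s (subst (_< toℕ j′) (sym (Fin.toℕ-inject₁ z)) z<j′)))
        (cong suc (Fin.toℕ-inject₁ z)))
  ... | tri≈ _ z≡j′ _ = ⊥-elim (z≢j′ z≡j′)
  ... | tri> _ _ j′<z rewrite idx-≥ j z j′<z = ρ-≥ j (suc z) (m≤n⇒m≤1+n j′<z)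

  ψ∘φ : ∀ z → ψ (φ z) ≡ z
  ψ∘φ z with z Fin.≟ j′
  ... | yes refl = cong ψ φ-j′
  ... | no z≢j′  = cong ψ (φ-≢ z≢j′)

  φ-injective : ∀ {a b} → φ a ≡ φ b → a ≡ b
  φ-injective {a} {b} φa≡φb = trans (sym (ψ∘φ a)) (trans (cong ψ φa≡φb) (ψ∘φ b))

  φ≢j : ∀ z → φ z ≢ j
  φ≢j z φz≡j with z Fin.≟ j′
  ... | yes refl = Fin.0≢1+n (trans (sym φ-j′) φz≡j)
  ... | no z≢j′  = z≢j′ (Fin.suc-injective (trans (sym (φ-≢ z≢j′)) φz≡j))

  φ∘ψ : ∀ x → φ (ψ x) ≡ skip p j x
  φ∘ψ x with x Fin.≟ j
  ... | yes refl = trans φ-j′ (sym πj≡0)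
  ... | no x≢j   = φ∘ψ-≢ x x≢j
    where
    φ∘ψ-≢ : ∀ x → x ≢ j → φ (ψ x) ≡ x
    φ∘ψ-≢ zero    _     = φ-j′
    φ∘ψ-≢ (suc y) 1+y≢j = φ-≢ (1+y≢j ∘ cong suc)

  ψ-suc : ∀ {y : Fin (suc m)} → y ≢ zero → suc (ψ y) ≡ y
  ψ-suc {zero}  y≢0 = ⊥-elim (y≢0 refl)
  ψ-suc {suc y} _   = refl

  p-≢0 : ∀ {x} → x ≢ j → p x ≢ zero
  p-≢0 {x} x≢j px≡0 = x≢j (begin
    x             ≡⟨ inverseˡ π ⟨
    π ⟨$⟩ˡ p x    ≡⟨ cong (π ⟨$⟩ˡ_) (trans px≡0 (sym πj≡0)) ⟩
    π ⟨$⟩ˡ p j    ≡⟨ inverseˡ π ⟩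
    j             ∎)
    where open ≡-Reasoning

  p⁻¹-≢j : ∀ w → π ⟨$⟩ˡ suc w ≢ j
  p⁻¹-≢j w eq = Fin.0≢1+n (trans (sym πj≡0) (trans (cong p (sym eq)) (inverseʳ π)))

  -- Since σ π j = π ∘ ρ j, the paper's π⋆ is ψ ∘ π ∘ φ.
  π⋆ : Permutation′ m
  π⋆ = permutation (λ z → ψ (p (φ z))) (λ w → ψ (π ⟨$⟩ˡ suc w)) right-inverse left-inverse
    where
    open ≡-Reasoning
    right-inverse : ∀ w → ψ (p (φ (ψ (π ⟨$⟩ˡ suc w)))) ≡ w
    right-inverse w = begin
      ψ (p (φ (ψ x)))  ≡⟨ cong (ψ ∘ p) (φ∘ψ x) ⟩
      ψ (p (skip p j x)) ≡⟨ cong (ψ ∘ p) (skip-≢ p j (p⁻¹-≢j w)) ⟩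
      ψ (p x)          ≡⟨ cong ψ (inverseʳ π) ⟩
      w                ∎
      where x = π ⟨$⟩ˡ suc w
    left-inverse : ∀ z → ψ (π ⟨$⟩ˡ suc (ψ (p (φ z)))) ≡ z
    left-inverse z = begin
      ψ (π ⟨$⟩ˡ suc (ψ (p (φ z)))) ≡⟨ cong (ψ ∘ (π ⟨$⟩ˡ_)) (ψ-suc (p-≢0 (φ≢j z))) ⟩
      ψ (π ⟨$⟩ˡ p (φ z))          ≡⟨ cong ψ (inverseˡ π) ⟩
      ψ (φ z)                      ≡⟨ ψ∘φ z ⟩
      z                            ∎

  π⋆-spec : ∀ i → suc (toℕ (π⋆ ⟨$⟩ʳ i)) ≡ toℕ (σ π j (idx j i))
  π⋆-spec i = cong toℕ (ψ-suc (p-≢0 (φ≢j i)))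

  φ∘π⋆ : ∀ z → φ (π⋆ ⟨$⟩ʳ z) ≡ bypass p j (φ z)
  φ∘π⋆ z = φ∘ψ (p (φ z))

  φ-reflects-orbits : ∀ {a b} → Orbit p (φ a) (φ b) → Orbit (π⋆ ⟨$⟩ʳ_) a b
  φ-reflects-orbits {a} {b} φa→φb = orbit-conj⁻ φ∘π⋆ φ-injective
    (subst₂ (Orbit (bypass p j)) (skip-≢ p j (φ≢j a)) (skip-≢ p j (φ≢j b))
      (orbit⇒orbit-bypass-skip p j pj≢j φa→φb))
    where
    pj≢j : p j ≢ j
    pj≢j pj≡j = Fin.0≢1+n (trans (sym πj≡0) pj≡j)

  ψ-reflects-orbits : ∀ {x y} → Orbit (π⋆ ⟨$⟩ʳ_) (ψ x) (ψ y) → Orbit p x y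
  ψ-reflects-orbits {x} {y} ψx→ψy = orbit-trans (orbit-skip p j x)
    (orbit-trans (subst₂ (Orbit p) (φ∘ψ x) (φ∘ψ y) (orbit-bypass⇒orbit p j (orbit-conj⁺ φ∘π⋆ ψx→ψy)))
      (Cycles.orbit-sym π (orbit-skip p j y)))

  γ-π⋆ : γ π ≡ γ π⋆
  γ-π⋆ = ≤-antisym (γ-≤ π π⋆ ψ ψ-reflects-orbits) (γ-≤ π⋆ π φ φ-reflects-orbits)

lemma1 : (m : ℕ) → 1 ≤ m → (π : Permutation′ (suc m)) → (j : Fin (suc m)) → j ≢ zero → π ⟨$⟩ʳ j ≡ zero
       → Σ (Permutation′ m) (λ πstar → ((i : Fin m) → suc (toℕ (πstar ⟨$⟩ʳ i)) ≡ toℕ (σ π j (idx j i))) × γ π ≡ γ πstar)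
-- The hypothesis 1 ≤ m is implied by j ≢ zero.
lemma1 m _ π zero     j≢0 _   = ⊥-elim (j≢0 refl)
lemma1 m _ π (suc j′) _   πj≡0 = π⋆ , π⋆-spec , γ-π⋆
  where open Reduction π j′ πj≡0
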